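{- Let $G$ be a connected graph with infinite node set and $^{*}G$ its enlargement with respect to a free ultrafilter $\mathcal F$ on $\mathbb N$, with principal galaxy $\Gamma_0$. If $^{*}G$ has a hypernode that is not in $\Gamma_0$, then there exists a two-way infinite sequence of galaxies of $^{*}G$ totally ordered according to their closeness to $\Gamma_0$; that is, there are galaxies $\Gamma_i$, $i\in\mathbb Z$, pairwise distinct, such that $\Gamma_i$ is closer to $\Gamma_0$ than is $\Gamma_j$ whenever $i<j$.
   Context: $G=\{X,B\}$ is a connected graph (branches are two-element subsets of $X$), $X$ infinite, not necessarily locally finite; $d$ is the shortest-path distance (number of branches). Hypernodes are classes $[x_n]$ of sequences of nodes modulo $\langle x_n\rangle\sim\langle y_n\rangle$ iff $\{n:x_n=y_n\}\in\mathcal F$; standard hypernodes have constant representatives. Hyperbranches are classes $[\{x_n,y_n\}]$ with $\{n:\{x_n,y_n\}\in B\}\in\mathcal F$; $^{*}G$ consists of all hypernodes and hyperbranches. Hypernodes $[x_n],[y_n]$ are limitedly distant if $\{n:d(x_n,y_n)\le k\}\in\mathcal F$ for some $k\in\mathbb N$; equivalence classes are nodal galaxies, and a galaxy consists of a nodal galaxy together with all hyperbranches with both ends in it. $\Gamma_0$ is the galaxy containing the standard hypernodes. For galaxies $\Gamma_a,\Gamma_b$ different from $\Gamma_0$, $\Gamma_a$ is closer to $\Gamma_0$ than is $\Gamma_b$ if there are $\mathbf y=[y_n]$ in $\Gamma_a$, $\mathbf z=[z_n]$ in $\Gamma_b$ and $\mathbf x=[x_n]$ in $\Gamma_0$ such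 that for every $m\in\mathbb N$, $\{n:d(z_n,x_n)-d(y_n,x_n)\ge m\}\in\mathcal F$. -}

module Defs where

open import Data.Nat using (ℕ; zero; suc; _≤_; _+_)
open import Data.Fin using (Fin)
open import Data.Unit using (⊤)
open import Data.Empty using (⊥)
open import Data.Product using (Σ; ∃; _×_; _,_)
open import Data.Sum using (_⊎_)
open import Function using (Surjective)
open import Relation.Nullary using (¬_)
open import Relation.Binary.PropositionalEquality using (_≡_; _≢_)

record FreeUltrafilter : Set₁ where
  field
    _∈F    : (ℕ → Set) → Set
    whole  : (λ _ → ⊤) ∈F
    upward : ∀ {A C : ℕ → Set} → A ∈F → (∀ n → A n → C n) → C ∈F
    inter  : ∀ {A C : ℕ → Set} → A ∈F → C ∈F → (λ n → A n × C n) ∈F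
    proper : ¬ ((λ _ → ⊥) ∈F)
    ultra  : (A : ℕ → Set) → A ∈F ⊎ (λ n → ¬ A n) ∈F
    free   : ∀ k → (λ n → k ≤ n) ∈F

-- Graphs: node set X, branches given by a symmetric irreflexive
-- adjacency relation (branches are two-element subsets of X).

record Graph : Set₁ where
  field
    X      : Set
    B      : X → X → Set
    B-sym  : ∀ {x y} → B x y → B y x
    B-irr  : ∀ {x} → ¬ B x x

module _ (G : Graph) where
  open Graph G

  Walk : X → X → ℕ → Set
  Walk x y zero    = x ≡ y
  Walk x y (suc k) = Σ X λ w → B x w × Walk w y k

  Connected : Set
  Connected = ∀ x y → ∃ λ k → Walk x y k

  InfiniteNodes : Set
  InfiniteNodes = ∀ n → ¬ (Σ (Fin n → X) λ f → Surjective _≡_ _≡_ f)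

  IsShortestPathDistance : (X → X → ℕ) → Set
  IsShortestPathDistance d =
    ∀ x y → Walk x y (d x y) × (∀ k → Walk x y k → d x y ≤ k)

module Enlargement (G : Graph) (d : Graph.X G → Graph.X G → ℕ)
                   (F : FreeUltrafilter) where
  open Graph G
  open FreeUltrafilter F

  -- representatives of hypernodes
  Seq : Set
  Seq = ℕ → X

  LimDist : Seq → Seq → Set
  LimDist x y = ∃ λ k → (λ n → d (x n) (y n) ≤ k) ∈F

  -- the hypernode [x_n] lies in Γ₀ (galaxy of the standard hypernodes)
  InΓ₀ : Seq → Set
  InΓ₀ x = ∃ λ (a : X) → LimDist (λ _ → a) x

  Closer : Seq → Seq → Set
  Closer u v = Σ Seq λ y → Σ Seq λ z → Σ Seq λ x →
    LimDist y u × LimDist z v × InΓ₀ x ×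
    (∀ (m : ℕ) → (λ n → d (y n) (x n) + m ≤ d (z n) (x n)) ∈F)

module Submission where

open import Defs
open import Data.Nat using (ℕ)
open import Data.Integer using (ℤ; _<_)
open import Data.Product using (Σ; ∃; _×_)
open import Relation.Nullary using (¬_)
open import Relation.Binary.PropositionalEquality using (_≢_)

open import Data.Nat using (zero; suc; _+_; _∸_; _≤_; z≤n; s≤s; ⌊_/2⌋)
open import Data.Nat.Properties
  using ( ≤-refl; ≤-reflexive; ≤-trans; ≤-antisym; <-irrefl; <⇒≤; ≰⇒>; n≤0⇒n≡0
        ; m≤n+m; +-assoc; +-suc; +-mono-≤; +-monoˡ-≤; +-monoʳ-≤; +-cancelʳ-≤
        ; m∸n≤m; m∸n+n≡m; m+[n∸m]≡n; m+n≤o⇒m≤o∸n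
        ; ⌊n/2⌋≤n; ⌊n/2⌋≤⌈n/2⌉; ⌊n/2⌋+⌈n/2⌉≡n; ⌊n/2⌋-mono; n≡⌊n+n/2⌋ )
  renaming (module ≤-Reasoning to ℕ-≤-Reasoning)
open import Data.Integer using (+_; -[1+_]; -<-; -<+; +<+)
import Data.Integer.Properties as ℤ
open import Data.Product using (_,_; proj₁; proj₂)
open import Data.Sum using (inj₁; inj₂)
open import Data.Empty using (⊥-elim)
open import Function using (_∘_)
open import Relation.Binary.Definitions using (tri<; tri≈; tri>)
open import Relation.Binary.PropositionalEquality
  using (_≡_; refl; sym; cong; subst; subst₂)

-- Fix a standard node a and a hypernode [x_n] outside Γ₀, so that r_n = d(a, x_n)
-- is unbounded along F. For each integer i take, on a geodesic from a to x_n, the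
-- node at distance scale i r_n from a. For i < j, scale j r - scale i r is at least
-- r / 2^c for some c, hence unbounded along F: these hypernodes lie in pairwise
-- distinct galaxies outside Γ₀, farther from a the larger i is.

Eventually : (ℕ → Set) → Set
Eventually P = ∃ λ R → ∀ r → R ≤ r → P r

⌊n/2⌋+⌊n/2⌋≤n : ∀ n → ⌊ n /2⌋ + ⌊ n /2⌋ ≤ n
⌊n/2⌋+⌊n/2⌋≤n n =
  ≤-trans (+-monoʳ-≤ ⌊ n /2⌋ (⌊n/2⌋≤⌈n/2⌉ n)) (≤-reflexive (⌊n/2⌋+⌈n/2⌉≡n n))

m+m≤n⇒m≤⌊n/2⌋ : ∀ {m n} → m + m ≤ n → m ≤ ⌊ n /2⌋
m+m≤n⇒m≤⌊n/2⌋ {m} le = subst (_≤ _) (sym (n≡⌊n+n/2⌋ m)) (⌊n/2⌋-mono le)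

halve^ : ℕ → ℕ → ℕ
halve^ zero    r = r
halve^ (suc c) r = ⌊ halve^ c r /2⌋

halve^-≤ : ∀ c r → halve^ c r ≤ r
halve^-≤ zero    r = ≤-refl
halve^-≤ (suc c) r = ≤-trans (⌊n/2⌋≤n _) (halve^-≤ c r)

halve^-antitone : ∀ {c e} r → c ≤ e → halve^ e r ≤ halve^ c r
halve^-antitone {e = e} r z≤n       = halve^-≤ e r
halve^-antitone         r (s≤s c≤e) = ⌊n/2⌋-mono (halve^-antitone r c≤e)

halve^-double : ∀ c r → halve^ (suc c) r + halve^ (suc c) r ≤ halve^ c r
halve^-double c r = ⌊n/2⌋+⌊n/2⌋≤n (halve^ c r)

halve^-unbounded : ∀ c m → Eventually (λ r → m ≤ halve^ c r)
halve^-unbounded zero    m = m , λ r m≤r → m≤r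
halve^-unbounded (suc c) m =
  let R , f = halve^-unbounded c (m + m) in R , λ r R≤r → m+m≤n⇒m≤⌊n/2⌋ (f r R≤r)

-- scale i r is about 2^(i-1) r for i < 0 and (1 - 2^(-i-1)) r for i ≥ 0.
scale : ℤ → ℕ → ℕ
scale -[1+ k ] r = halve^ (2 + k) r
scale (+ k)    r = r ∸ halve^ (1 + k) r

scale-≤ : ∀ i r → scale i r ≤ r
scale-≤ -[1+ k ] r = halve^-≤ (2 + k) r
scale-≤ (+ k)    r = m∸n≤m r (halve^ (1 + k) r)

scale-gap : ∀ {i j} → i < j → ∃ λ c → ∀ r → scale i r + halve^ c r ≤ scale j r
scale-gap { -[1+ a ]} { -[1+ b ]} (-<- b<a) = 3 + b , λ r → begin
  halve^ (2 + a) r + halve^ (3 + b) r  ≤⟨ +-monoˡ-≤ _ (halve^-antitone r (s≤s (s≤s b<a))) ⟩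
  halve^ (3 + b) r + halve^ (3 + b) r  ≤⟨ halve^-double (2 + b) r ⟩
  halve^ (2 + b) r                     ∎
  where open ℕ-≤-Reasoning
scale-gap { -[1+ a ]} {+ b} -<+ = 2 , λ r → m+n≤o⇒m≤o∸n _ (begin
  halve^ (2 + a) r + halve^ 2 r + halve^ (1 + b) r
    ≤⟨ +-mono-≤ (+-monoˡ-≤ _ (halve^-antitone {2} {2 + a} r (s≤s (s≤s z≤n))))
                (halve^-antitone {1} {1 + b} r (s≤s z≤n)) ⟩
  halve^ 2 r + halve^ 2 r + halve^ 1 r ≤⟨ +-monoˡ-≤ _ (halve^-double 1 r) ⟩
  halve^ 1 r + halve^ 1 r              ≤⟨ halve^-double 0 r ⟩
  r                                    ∎)
  where open ℕ-≤-Reasoning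
scale-gap {+ a} {+ b} (+<+ a<b) = 2 + a , λ r → m+n≤o⇒m≤o∸n _ (begin
  r ∸ halve^ (1 + a) r + halve^ (2 + a) r + halve^ (1 + b) r
    ≡⟨ +-assoc (r ∸ halve^ (1 + a) r) _ _ ⟩
  r ∸ halve^ (1 + a) r + (halve^ (2 + a) r + halve^ (1 + b) r)
    ≤⟨ +-monoʳ-≤ (r ∸ halve^ (1 + a) r) (+-monoʳ-≤ _ (halve^-antitone r (s≤s a<b))) ⟩
  r ∸ halve^ (1 + a) r + (halve^ (2 + a) r + halve^ (2 + a) r)
    ≤⟨ +-monoʳ-≤ (r ∸ halve^ (1 + a) r) (halve^-double (1 + a) r) ⟩
  r ∸ halve^ (1 + a) r + halve^ (1 + a) r
    ≡⟨ m∸n+n≡m (halve^-≤ (1 + a) r) ⟩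
  r ∎)
  where open ℕ-≤-Reasoning

scale-separates : ∀ {i j} → i < j → ∀ m → Eventually (λ r → scale i r + m ≤ scale j r)
scale-separates i<j m =
  let c , gap = scale-gap i<j
      R , f   = halve^-unbounded c m
  in R , λ r R≤r → ≤-trans (+-monoʳ-≤ _ (f r R≤r)) (gap r)

scale-unbounded : ∀ i m → Eventually (λ r → m ≤ scale i r)
scale-unbounded i m =
  let R , f = scale-separates (ℤ.i≤pred[j]⇒i<j {j = i} ℤ.≤-refl) m
  in R , λ r R≤r → ≤-trans (m≤n+m m _) (f r R≤r)

module Walks (G : Graph) where
  open Graph G

  walk-++ : ∀ {x y z} k l → Walk G x y k → Walk G y z l → Walk G x z (k + l)
  walk-++ zero    l refl        w′ = w′
  walk-++ (suc k) l (u , b , w) w′ = u , b , walk-++ k l w w′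

  walk-snoc : ∀ {x y z} k → Walk G x y k → B y z → Walk G x z (suc k)
  walk-snoc zero    refl         b = _ , b , refl
  walk-snoc (suc k) (u , b′ , w) b = u , b′ , walk-snoc k w b

  walk-reverse : ∀ {x y} k → Walk G x y k → Walk G y x k
  walk-reverse zero    refl        = refl
  walk-reverse (suc k) (u , b , w) = walk-snoc k (walk-reverse k w) (B-sym b)

  walk-split : ∀ {x y} t k → t ≤ k → Walk G x y k →
               Σ X λ p → Walk G x p t × Walk G p y (k ∸ t)
  walk-split zero    k       _         w           = _ , refl , w
  walk-split (suc t) (suc k) (s≤s t≤k) (u , b , w) =
    let p , w₁ , w₂ = walk-split t k t≤k w in p , (u , b , w₁) , w₂

module Metric (G : Graph) (d : Graph.X G → Graph.X G → ℕ)
              (sp : IsShortestPathDistance G d) where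
  open Graph G
  open Walks G

  geodesic : ∀ x y → Walk G x y (d x y)
  geodesic x y = proj₁ (sp x y)

  d-minimal : ∀ {x y} k → Walk G x y k → d x y ≤ k
  d-minimal {x} {y} = proj₂ (sp x y)

  d-refl : ∀ x → d x x ≡ 0
  d-refl x = n≤0⇒n≡0 (d-minimal 0 refl)

  d-sym : ∀ x y → d x y ≡ d y x
  d-sym x y = ≤-antisym (d-minimal _ (walk-reverse _ (geodesic y x)))
                        (d-minimal _ (walk-reverse _ (geodesic x y)))

  d-triangle : ∀ x y z → d x z ≤ d x y + d y z
  d-triangle x y z = d-minimal _ (walk-++ (d x y) (d y z) (geodesic x y) (geodesic y z))

  geodesic-point : ∀ x y t → t ≤ d x y → Σ X λ p → d x p ≡ t
  geodesic-point x y t t≤d =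
    let p , w₁ , w₂ = walk-split t (d x y) t≤d (geodesic x y)
        d≤ : d x y ≤ d x p + (d x y ∸ t)
        d≤ = d-minimal _ (walk-++ (d x p) _ (geodesic x p) w₂)
        t+[d∸t]≤ : t + (d x y ∸ t) ≤ d x p + (d x y ∸ t)
        t+[d∸t]≤ = subst (_≤ d x p + (d x y ∸ t)) (sym (m+[n∸m]≡n t≤d)) d≤
    in p , ≤-antisym (d-minimal t w₁) (+-cancelʳ-≤ (d x y ∸ t) t (d x p) t+[d∸t]≤)

module Galaxies (G : Graph) (d : Graph.X G → Graph.X G → ℕ)
                (sp : IsShortestPathDistance G d) (F : FreeUltrafilter) where
  open Graph G
  open Metric G d sp
  open FreeUltrafilter F
  open Enlargement G d F

  Tends : (ℕ → ℕ) → Set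
  Tends s = ∀ R → (λ n → R ≤ s n) ∈F

  eventually-along : ∀ {s P} → Tends s → Eventually P → (λ n → P (s n)) ∈F
  eventually-along s→∞ (R , f) = upward (s→∞ R) (λ n R≤s → f _ R≤s)

  LimDist-refl : ∀ u → LimDist u u
  LimDist-refl u = 0 , upward whole (λ n _ → ≤-reflexive (d-refl (u n)))

  LimDist-sym : ∀ u v → LimDist u v → LimDist v u
  LimDist-sym u v (K , fK) = K , upward fK (λ n → subst (_≤ K) (d-sym (u n) (v n)))

  ¬InΓ₀⇒tends : ∀ a x → ¬ InΓ₀ x → Tends (λ n → d a (x n))
  ¬InΓ₀⇒tends a x x∉Γ₀ R with ultra (λ n → d a (x n) ≤ R)
  ... | inj₁ bounded   = ⊥-elim (x∉Γ₀ (a , R , bounded))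
  ... | inj₂ unbounded = upward unbounded (λ n d≰R → <⇒≤ (≰⇒> d≰R))

  tends⇒¬InΓ₀ : ∀ a x → Tends (λ n → d a (x n)) → ¬ InΓ₀ x
  tends⇒¬InΓ₀ a x x→∞ (b , K , fK) =
    proper (upward (inter fK (x→∞ (suc (d a b + K)))) λ n (d≤K , far) →
      let near : d a (x n) ≤ d a b + K
          near = ≤-trans (d-triangle a b (x n)) (+-monoʳ-≤ (d a b) d≤K)
      in <-irrefl refl (≤-trans (s≤s near) far))

  Recedes : X → Seq → Seq → Set
  Recedes a y z = ∀ m → (λ n → d a (y n) + m ≤ d a (z n)) ∈F

  recedes⇒¬LimDist : ∀ a y z → Recedes a y z → ¬ LimDist y z
  recedes⇒¬LimDist a y z rec (K , fK) =
    proper (upward (inter fK (rec (suc K))) λ n (d≤K , far) →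
      let near : d a (z n) ≤ d a (y n) + K
          near = ≤-trans (d-triangle a (y n) (z n)) (+-monoʳ-≤ (d a (y n)) d≤K)
      in <-irrefl refl (≤-trans (s≤s near) (subst (_≤ d a (z n)) (+-suc _ K) far)))

  recedes⇒Closer : ∀ a y z → Recedes a y z → Closer y z
  recedes⇒Closer a y z rec =
    y , z , (λ _ → a) , LimDist-refl y , LimDist-refl z , (a , LimDist-refl (λ _ → a)) ,
    λ m → upward (rec m) (λ n → subst₂ _≤_ (cong (_+ m) (d-sym a (y n))) (d-sym a (z n)))

  module Ladder (a : X) (x : Seq) (x∉Γ₀ : ¬ InΓ₀ x) where
    radius : ℕ → ℕ
    radius n = d a (x n)

    rung-on-geodesic : ∀ i n → Σ X λ p → d a p ≡ scale i (radius n)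
    rung-on-geodesic i n = geodesic-point a (x n) (scale i (radius n)) (scale-≤ i (radius n))

    rung : ℤ → Seq
    rung i n = proj₁ (rung-on-geodesic i n)

    d-rung : ∀ i n → d a (rung i n) ≡ scale i (radius n)
    d-rung i n = proj₂ (rung-on-geodesic i n)

    radius-tends : Tends radius
    radius-tends = ¬InΓ₀⇒tends a x x∉Γ₀

    rung-∉Γ₀ : ∀ i → ¬ InΓ₀ (rung i)
    rung-∉Γ₀ i = tends⇒¬InΓ₀ a (rung i) λ R →
      upward (eventually-along radius-tends (scale-unbounded i R))
             (λ n → subst (R ≤_) (sym (d-rung i n)))

    rung-recedes : ∀ {i j} → i < j → Recedes a (rung i) (rung j)
    rung-recedes {i} {j} i<j m =
      upward (eventually-along radius-tends (scale-separates i<j m))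
             (λ n → subst₂ _≤_ (cong (_+ m) (sym (d-rung i n))) (sym (d-rung j n)))

    rungs-¬LimDist : ∀ i j → i ≢ j → ¬ LimDist (rung i) (rung j)
    rungs-¬LimDist i j i≢j with ℤ.<-cmp i j
    ... | tri< i<j _   _   = recedes⇒¬LimDist a _ _ (rung-recedes i<j)
    ... | tri≈ _   i≡j _   = ⊥-elim (i≢j i≡j)
    ... | tri> _   _   j<i = recedes⇒¬LimDist a _ _ (rung-recedes j<i) ∘ LimDist-sym _ _

theorem4p2 : (G : Graph) (F : FreeUltrafilter) (d : Graph.X G → Graph.X G → ℕ) →
    Connected G → InfiniteNodes G → IsShortestPathDistance G d →
    let open Enlargement G d F in
    (∃ λ (x : Seq) → ¬ InΓ₀ x) →
    Σ (ℤ → Seq) λ Γ →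
    (∀ i → ¬ InΓ₀ (Γ i)) ×
    (∀ i j → i ≢ j → ¬ LimDist (Γ i) (Γ j)) ×
    (∀ i j → i < j → Closer (Γ i) (Γ j))
theorem4p2 G F d _ _ sp (x , x∉Γ₀) =
  rung , rung-∉Γ₀ , rungs-¬LimDist ,
  λ i j i<j → recedes⇒Closer (x 0) (rung i) (rung j) (rung-recedes i<j)
  where open Galaxies G d sp F
        open Ladder (x 0) x x∉Γ₀
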